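{- Let $K$ be a number field, $a\in K$ and $f=x^2+a\in K[x]$. Let $c_1=-f(0)=-a$ and $c_n=f^n(0)$ for $n\geq2$, and fix a finite place $v$ of $K$. Then: (1) For every $n\geq1$, $v(c_n)<0$ if and only if $v(c_1)<0$, and in that case $v(c_n)=2^{n-1}v(c_1)$. (2) If $n=\min\{i\geq1: v(c_i)>0\}$, then for every $m\geq1$, $v(c_m)=v(c_n)$ if $n\mid m$, and $v(c_m)=0$ otherwise.
   Context: $f^n$ denotes the $n$-fold iterate of $f$. -}

module Defs where

open import Level using (Level; _⊔_) renaming (suc to lsuc)
open import Data.Nat using (ℕ; zero; suc)
open import Data.Fin using (Fin; zero; suc)
open import Data.Integer as ℤ using (ℤ)
open import Data.Rational as ℚ using (ℚ)
open import Data.Product using (Σ; ∃; _×_; _,_)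
open import Data.Empty using (⊥)
open import Data.Unit using (⊤)
open import Relation.Nullary using (¬_)
open import Relation.Binary.PropositionalEquality using (_≡_)
open import Algebra.Bundles using (CommutativeRing)
open import Function.Bundles using (_⇔_)

∑ : ∀ {a} {A : Set a} → (A → A → A) → A → (n : ℕ) → (Fin n → A) → A
∑ _+_ z zero    f = z
∑ _+_ z (suc n) f = f zero + ∑ _+_ z n (λ i → f (suc i))

iter : ∀ {a} {A : Set a} → ℕ → (A → A) → A → A
iter zero    f x = x
iter (suc n) f x = f (iter n f x)

record NumberField (c ℓ : Level) : Set (lsuc (c ⊔ ℓ)) where
  field
    commRing : CommutativeRing c ℓ
  open CommutativeRing commRing public hiding (ring)
  field
    0≉1     : ¬ (0# ≈ 1#)
    inverse : ∀ x → ¬ (x ≈ 0#) → ∃ λ y → x * y ≈ 1#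
    ι       : ℚ → Carrier
    ι-+     : ∀ p q → ι (p ℚ.+ q) ≈ ι p + ι q
    ι-*     : ∀ p q → ι (p ℚ.* q) ≈ ι p * ι q
    ι-1     : ι ℚ.1ℚ ≈ 1#
    degree      : ℕ
    basis       : Fin degree → Carrier
    spans       : ∀ x → ∃ λ (co : Fin degree → ℚ) →
                    x ≈ ∑ _+_ 0# degree (λ i → ι (co i) * basis i)
    independent : ∀ (co : Fin degree → ℚ) →
                    ∑ _+_ 0# degree (λ i → ι (co i) * basis i) ≈ 0# →
                    ∀ i → co i ≡ ℚ.0ℚ

data ℤ∞ : Set where
  fin : ℤ → ℤ∞
  ∞   : ℤ∞

_+∞_ : ℤ∞ → ℤ∞ → ℤ∞
fin x +∞ fin y = fin (x ℤ.+ y)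
fin x +∞ ∞     = ∞
∞     +∞ _     = ∞

min∞ : ℤ∞ → ℤ∞ → ℤ∞
min∞ (fin x) (fin y) = fin (x ℤ.⊓ y)
min∞ (fin x) ∞       = fin x
min∞ ∞       y       = y

_≤∞_ : ℤ∞ → ℤ∞ → Set
fin x ≤∞ fin y = x ℤ.≤ y
fin x ≤∞ ∞     = ⊤
∞     ≤∞ fin y = ⊥
∞     ≤∞ ∞     = ⊤

Neg : ℤ∞ → Set
Neg (fin x) = x ℤ.< ℤ.0ℤ
Neg ∞       = ⊥

Pos : ℤ∞ → Set
Pos (fin x) = ℤ.0ℤ ℤ.< x
Pos ∞       = ⊤

-- A finite place of a number field K, given by its normalised discrete
-- valuation v : K → ℤ ∪ {∞} (non-archimedean, surjective onto ℤ).

record FinitePlace {c ℓ} (K : NumberField c ℓ) : Set (c ⊔ ℓ) where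
  open NumberField K
  field
    v      : Carrier → ℤ∞
    v-cong : ∀ {x y} → x ≈ y → v x ≡ v y
    v-∞    : ∀ x → (v x ≡ ∞) ⇔ (x ≈ 0#)
    v-*    : ∀ x y → v (x * y) ≡ v x +∞ v y
    v-+    : ∀ x y → min∞ (v x) (v y) ≤∞ v (x + y)
    v-surj : ∀ z → ∃ λ x → v x ≡ fin z

-- The sequence c_n for f = x² + a :
--   c_1 = -f(0) = -a,  c_n = f^n(0) for n ≥ 2  (c_0 := 0, unused)

module _ {c ℓ} (K : NumberField c ℓ) where
  open NumberField K

  quad : Carrier → Carrier → Carrier
  quad a x = x * x + a

  cseq : Carrier → ℕ → Carrier
  cseq a zero          = 0#
  cseq a (suc zero)    = - a
  cseq a (suc (suc n)) = iter (suc (suc n)) (quad a) 0#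

{-# OPTIONS --safe #-}
module Submission where

-- Write fⁿ for the n-th iterate of f = x² + a and νₙ = v(fⁿ(0)), so that v(cₙ) = νₙ for n ≥ 1.
-- If v(a) < 0, squaring dominates the constant term at every step, which doubles the valuation.
-- Otherwise a is v-integral, hence so is every fⁿ(y) with y integral, and fᵏ(y) ≡ fᵏ(0) mod y²
-- (since f(y) − f(z) = (y − z)(y + z)).  Taking y = fⁿ(0) with νₙ > 0 gives
-- fᵏ⁺ⁿ(0) = fᵏ(0) + (an element of valuation ≥ 2νₙ), so νₖ₊ₙ = νₖ whenever νₖ ∈ {0, νₙ}.
-- Minimality of n makes νₘ = 0 for 1 ≤ m < n, and strong induction on m finishes.

open import Defs
open import Data.Nat using (ℕ; _≤_; _<_; _∸_; _^_)
open import Data.Nat.Divisibility using (_∣_)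
open import Data.Integer as ℤ using (ℤ)
open import Data.Product using (_×_)
open import Relation.Nullary using (¬_)
open import Relation.Binary.PropositionalEquality using (_≡_)
open import Function.Bundles using (_⇔_)

open import Data.Nat as ℕ using (zero; suc)
import Data.Nat.Properties as ℕP
import Data.Nat.Divisibility as ℕD
import Data.Integer.Properties as ℤP
import Algebra.Properties.Ring as RingProperties
open import Algebra.Bundles using (CommutativeRing)
open import Data.Product using (∃; _,_)
open import Data.Sum using (_⊎_; inj₁; inj₂)
open import Data.Empty using (⊥-elim)
open import Data.Unit using (tt)
open import Relation.Nullary using (yes; no)
open import Relation.Binary.PropositionalEquality as ≡ using (refl; cong; subst)
open import Relation.Binary.Definitions using (tri<; tri≈; tri>)
open import Function.Bundles using (Equivalence; mk⇔)
open import Data.Nat.Induction using (<-rec)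
import Relation.Binary.Reasoning.Setoid as SetoidReasoning

2^suc*z : ∀ k z → ℤ.+ (2 ^ suc k) ℤ.* z ≡ ℤ.+ (2 ^ k) ℤ.* z ℤ.+ ℤ.+ (2 ^ k) ℤ.* z
2^suc*z k z = begin
  ℤ.+ (2 ^ k ℕ.+ (2 ^ k ℕ.+ 0)) ℤ.* z   ≡⟨ cong (λ m → ℤ.+ (2 ^ k ℕ.+ m) ℤ.* z) (ℕP.+-identityʳ (2 ^ k)) ⟩
  ℤ.+ (2 ^ k ℕ.+ 2 ^ k) ℤ.* z           ≡⟨ cong (ℤ._* z) (ℤP.pos-+ (2 ^ k) (2 ^ k)) ⟩
  (ℤ.+ (2 ^ k) ℤ.+ ℤ.+ (2 ^ k)) ℤ.* z   ≡⟨ ℤP.*-distribʳ-+ z (ℤ.+ (2 ^ k)) (ℤ.+ (2 ^ k)) ⟩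
  ℤ.+ (2 ^ k) ℤ.* z ℤ.+ ℤ.+ (2 ^ k) ℤ.* z ∎
  where open ≡.≡-Reasoning

neg⇒i+i<i : ∀ {i} → i ℤ.< ℤ.0ℤ → i ℤ.+ i ℤ.< i
neg⇒i+i<i {i} i<0 = subst (i ℤ.+ i ℤ.<_) (ℤP.+-identityʳ i) (ℤP.+-monoʳ-< i i<0)

pos⇒i<i+i : ∀ {i} → ℤ.0ℤ ℤ.< i → i ℤ.< i ℤ.+ i
pos⇒i<i+i {i} 0<i = subst (ℤ._< i ℤ.+ i) (ℤP.+-identityʳ i) (ℤP.+-monoʳ-< i 0<i)

2^k*z≤z : ∀ {z} → z ℤ.< ℤ.0ℤ → ∀ k → ℤ.+ (2 ^ k) ℤ.* z ℤ.≤ z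
2^k*z≤z {z} z<0 zero    = ℤP.≤-reflexive (ℤP.*-identityˡ z)
2^k*z≤z {z} z<0 (suc k) = subst (ℤ._≤ z) (≡.sym (2^suc*z k z))
  (ℤP.<⇒≤ (ℤP.<-≤-trans (neg⇒i+i<i (ℤP.≤-<-trans (2^k*z≤z z<0 k) z<0)) (2^k*z≤z z<0 k)))

NonNeg : ℤ∞ → Set
NonNeg u = fin ℤ.0ℤ ≤∞ u

≤∞-refl : ∀ u → u ≤∞ u
≤∞-refl (fin x) = ℤP.≤-refl
≤∞-refl ∞       = tt

≤∞-trans : ∀ {u v w} → u ≤∞ v → v ≤∞ w → u ≤∞ w
≤∞-trans {fin x} {fin y} {fin z} p q = ℤP.≤-trans p q
≤∞-trans {fin x} {v}     {∞}     p q = tt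
≤∞-trans {∞}     {∞}     {∞}     p q = tt

≤∞-antisym : ∀ {u v} → u ≤∞ v → v ≤∞ u → u ≡ v
≤∞-antisym {fin x} {fin y} p q = cong fin (ℤP.≤-antisym p q)
≤∞-antisym {∞}     {∞}     p q = refl

≤∞-total : ∀ u v → u ≤∞ v ⊎ v ≤∞ u
≤∞-total (fin x) (fin y) = ℤP.≤-total x y
≤∞-total (fin x) ∞       = inj₁ tt
≤∞-total ∞       (fin y) = inj₂ tt
≤∞-total ∞       ∞       = inj₁ tt

∞≤⇒≡∞ : ∀ {u} → ∞ ≤∞ u → u ≡ ∞
∞≤⇒≡∞ {∞} _ = refl

min∞-≤-sel : ∀ u v w → min∞ u v ≤∞ w → u ≤∞ w ⊎ v ≤∞ w
min∞-≤-sel (fin x) (fin y) (fin z) p with ℤP.⊓-sel x y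
... | inj₁ x⊓y≡x = inj₁ (subst (ℤ._≤ z) x⊓y≡x p)
... | inj₂ x⊓y≡y = inj₂ (subst (ℤ._≤ z) x⊓y≡y p)
min∞-≤-sel (fin x) (fin y) ∞ p = inj₁ tt
min∞-≤-sel (fin x) ∞       w p = inj₁ p
min∞-≤-sel ∞       v       w p = inj₂ p

min∞-greatest : ∀ {u v w} → u ≤∞ v → u ≤∞ w → u ≤∞ min∞ v w
min∞-greatest {fin x} {fin y} {fin z} p q with ℤP.⊓-sel y z
... | inj₁ y⊓z≡y = subst (x ℤ.≤_) (≡.sym y⊓z≡y) p
... | inj₂ y⊓z≡z = subst (x ℤ.≤_) (≡.sym y⊓z≡z) q
min∞-greatest {fin x} {fin y} {∞} p q = p
min∞-greatest {u}     {∞}     {w} p q = q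

+∞-mono-≤ : ∀ {u u′ w w′} → u ≤∞ u′ → w ≤∞ w′ → (u +∞ w) ≤∞ (u′ +∞ w′)
+∞-mono-≤ {fin x} {fin x′} {fin y} {fin y′} p q = ℤP.+-mono-≤ p q
+∞-mono-≤ {fin x} {fin x′} {fin y} {∞}      p q = tt
+∞-mono-≤ {fin x} {fin x′} {∞}     {∞}      p q = tt
+∞-mono-≤ {fin x} {∞}      {fin y} {w′}     p q = tt
+∞-mono-≤ {fin x} {∞}      {∞}     {∞}      p q = tt
+∞-mono-≤ {∞}     {∞}      {w}     {w′}     p q = tt

+∞-identityˡ : ∀ u → fin ℤ.0ℤ +∞ u ≡ u
+∞-identityˡ (fin x) = cong fin (ℤP.+-identityˡ x)
+∞-identityˡ ∞       = refl

+∞-identityʳ : ∀ u → u +∞ fin ℤ.0ℤ ≡ u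
+∞-identityʳ (fin x) = cong fin (ℤP.+-identityʳ x)
+∞-identityʳ ∞       = refl

≤-+∞-nonNeg : ∀ {u v w} → u ≤∞ v → NonNeg w → u ≤∞ (v +∞ w)
≤-+∞-nonNeg {u} {v} {w} p q = subst (_≤∞ (v +∞ w)) (+∞-identityʳ u) (+∞-mono-≤ p q)

u≡u+u⇒u≡∞⊎u≡0 : ∀ u → u ≡ u +∞ u → u ≡ ∞ ⊎ u ≡ fin ℤ.0ℤ
u≡u+u⇒u≡∞⊎u≡0 (fin x) x≡x+x = inj₂ (cong fin (RingProperties.x+x≈x⇒x≈0 ℤP.+-*-ring x (≡.sym (fin-injective x≡x+x))))
  where
  fin-injective : ∀ {x y} → fin x ≡ fin y → x ≡ y
  fin-injective refl = refl
u≡u+u⇒u≡∞⊎u≡0 ∞ _ = inj₁ refl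

u+u≡0⇒u≡0 : ∀ u → u +∞ u ≡ fin ℤ.0ℤ → u ≡ fin ℤ.0ℤ
u+u≡0⇒u≡0 (fin (ℤ.+ zero)) _ = refl

Neg⇒¬NonNeg : ∀ {u} → Neg u → ¬ NonNeg u
Neg⇒¬NonNeg {fin x} x<0 0≤x = ℤP.<-irrefl refl (ℤP.≤-<-trans 0≤x x<0)

Pos⇒NonNeg : ∀ {u} → Pos u → NonNeg u
Pos⇒NonNeg {fin x} 0<x = ℤP.<⇒≤ 0<x
Pos⇒NonNeg {∞}     _   = tt

¬Pos⇒NonNeg⇒≡0 : ∀ {u} → ¬ Pos u → NonNeg u → u ≡ fin ℤ.0ℤ
¬Pos⇒NonNeg⇒≡0 {fin x} x≯0 0≤x = cong fin (ℤP.≤-antisym (ℤP.≮⇒≥ x≯0) 0≤x)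
¬Pos⇒NonNeg⇒≡0 {∞}     ∞≯0 _   = ⊥-elim (∞≯0 tt)

nonNeg⊎neg : ∀ u → NonNeg u ⊎ ∃ λ z → u ≡ fin z × z ℤ.< ℤ.0ℤ
nonNeg⊎neg ∞ = inj₁ tt
nonNeg⊎neg (fin z) with z ℤP.<? ℤ.0ℤ
... | yes z<0 = inj₂ (z , refl , z<0)
... | no  z≮0 = inj₁ (ℤP.≮⇒≥ z≮0)

Pos-double-≤⇒> : ∀ {p d q} → Pos p → (p +∞ p) ≤∞ d → q ≤∞ p → d ≡ ∞ ⊎ ¬ (d ≤∞ q)
Pos-double-≤⇒> {fin x} {fin y} {q} 0<x x+x≤y q≤x = inj₂ λ y≤q →
  ℤP.<-irrefl refl (ℤP.<-≤-trans (pos⇒i<i+i 0<x) (ℤP.≤-trans x+x≤y (≤∞-trans {fin y} {q} y≤q q≤x)))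
Pos-double-≤⇒> {fin x} {∞}     _ _ _ = inj₁ refl
Pos-double-≤⇒> {∞}     {d}     _ ∞≤d _ = inj₁ (∞≤⇒≡∞ ∞≤d)

iter-+ : ∀ {a} {A : Set a} k n (f : A → A) x → iter (k ℕ.+ n) f x ≡ iter k f (iter n f x)
iter-+ zero    n f x = refl
iter-+ (suc k) n f x = cong f (iter-+ k n f x)

module RingIdentities {c ℓ} (R : CommutativeRing c ℓ) where
  open CommutativeRing R
  open RingProperties ring
  open SetoidReasoning setoid

  x≈y+[x-y] : ∀ x y → x ≈ y + (x - y)
  x≈y+[x-y] x y = sym (begin
    y + (x - y)    ≈⟨ +-congˡ (+-comm x (- y)) ⟩
    y + (- y + x)  ≈⟨ sym (+-assoc y (- y) x) ⟩
    (y - y) + x    ≈⟨ +-congʳ (-‿inverseʳ y) ⟩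
    0# + x         ≈⟨ +-identityˡ x ⟩
    x              ∎)

  [x+a]-[y+a]≈x-y : ∀ x y a → (x + a) - (y + a) ≈ x - y
  [x+a]-[y+a]≈x-y x y a = begin
    (x + a) - (y + a)    ≈⟨ +-congˡ (-‿anti-homo-+ y a) ⟩
    (x + a) + (- a - y)  ≈⟨ +-assoc x a (- a - y) ⟩
    x + (a + (- a - y))  ≈⟨ +-congˡ (sym (+-assoc a (- a) (- y))) ⟩
    x + ((a - a) - y)    ≈⟨ +-congˡ (+-congʳ (-‿inverseʳ a)) ⟩
    x + (0# - y)         ≈⟨ +-congˡ (+-identityˡ (- y)) ⟩
    x - y                ∎

  [x-y]+[y-z]≈x-z : ∀ x y z → (x - y) + (y - z) ≈ x - z
  [x-y]+[y-z]≈x-z x y z = begin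
    (x - y) + (y - z)    ≈⟨ +-assoc x (- y) (y - z) ⟩
    x + (- y + (y - z))  ≈⟨ +-congˡ (sym (+-assoc (- y) y (- z))) ⟩
    x + ((- y + y) - z)  ≈⟨ +-congˡ (+-congʳ (-‿inverseˡ y)) ⟩
    x + (0# - z)         ≈⟨ +-congˡ (+-identityˡ (- z)) ⟩
    x - z                ∎

  [x²+a]-[y²+a]≈[x-y][x+y] : ∀ a x y → (x * x + a) - (y * y + a) ≈ (x - y) * (x + y)
  [x²+a]-[y²+a]≈[x-y][x+y] a x y = begin
    (x * x + a) - (y * y + a)        ≈⟨ [x+a]-[y+a]≈x-y (x * x) (y * y) a ⟩
    x * x - y * y                    ≈⟨ sym ([x-y]+[y-z]≈x-z (x * x) (x * y) (y * y)) ⟩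
    (x * x - x * y) + (x * y - y * y) ≈⟨ +-congˡ (+-congʳ (*-comm x y)) ⟩
    (x * x - x * y) + (y * x - y * y) ≈⟨ sym (+-cong (x[y-z]≈xy-xz x x y) (x[y-z]≈xy-xz y x y)) ⟩
    x * (x - y) + y * (x - y)        ≈⟨ sym (distribʳ (x - y) x y) ⟩
    (x + y) * (x - y)                ≈⟨ *-comm (x + y) (x - y) ⟩
    (x - y) * (x + y)                ∎

  [x+y]-y≈x : ∀ x y → (x + y) - y ≈ x
  [x+y]-y≈x x y = trans (+-assoc x y (- y)) (trans (+-congˡ (-‿inverseʳ y)) (+-identityʳ x))

  x-0≈x : ∀ x → x - 0# ≈ x
  x-0≈x x = trans (+-congˡ -0#≈0#) (+-identityʳ x)

module Valuation {c ℓ} {K : NumberField c ℓ} (P : FinitePlace K) where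
  open NumberField K renaming (refl to ≈-refl)
  open FinitePlace P
  open RingProperties (CommutativeRing.ring commRing) using (-1*x≈-x; -‿involutive)
  open RingIdentities commRing using ([x+y]-y≈x)
  open Equivalence

  v-0 : v 0# ≡ ∞
  v-0 = from (v-∞ 0#) ≈-refl

  v-1 : v 1# ≡ fin ℤ.0ℤ
  v-1 with u≡u+u⇒u≡∞⊎u≡0 (v 1#) (≡.trans (v-cong (sym (*-identityˡ 1#))) (v-* 1# 1#))
  ... | inj₁ v1≡∞ = ⊥-elim (0≉1 (sym (to (v-∞ 1#) v1≡∞)))
  ... | inj₂ v1≡0 = v1≡0

  v-‿ : ∀ x → v (- x) ≡ v x
  v-‿ x = begin
    v (- x)             ≡⟨ v-cong (sym (-1*x≈-x x)) ⟩
    v (- 1# * x)        ≡⟨ v-* (- 1#) x ⟩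
    v (- 1#) +∞ v x     ≡⟨ cong (_+∞ v x) v-[-1]≡0 ⟩
    fin ℤ.0ℤ +∞ v x     ≡⟨ +∞-identityˡ (v x) ⟩
    v x                 ∎
    where
    open ≡.≡-Reasoning
    v-[-1]≡0 : v (- 1#) ≡ fin ℤ.0ℤ
    v-[-1]≡0 = u+u≡0⇒u≡0 (v (- 1#))
      (≡.trans (≡.sym (v-* (- 1#) (- 1#))) (≡.trans (v-cong (trans (-1*x≈-x (- 1#)) (-‿involutive 1#))) v-1))

  v-+-≥ : ∀ {u x y} → u ≤∞ v x → u ≤∞ v y → u ≤∞ v (x + y)
  v-+-≥ {x = x} {y} p q = ≤∞-trans (min∞-greatest p q) (v-+ x y)

  v-*-nonNeg : ∀ {x y} → NonNeg (v x) → NonNeg (v y) → NonNeg (v (x * y))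
  v-*-nonNeg {x} {y} p q = subst NonNeg (≡.sym (v-* x y)) (≤-+∞-nonNeg p q)

  v-+-dominated : ∀ x y → v y ≡ ∞ ⊎ ¬ (v y ≤∞ v x) → v (x + y) ≡ v x
  v-+-dominated x y (inj₁ vy≡∞) = v-cong (trans (+-congˡ (to (v-∞ y) vy≡∞)) (+-identityʳ x))
  v-+-dominated x y (inj₂ vy≰vx) with ≤∞-total (v x) (v y)
  ... | inj₂ vy≤vx = ⊥-elim (vy≰vx vy≤vx)
  ... | inj₁ vx≤vy with min∞-≤-sel (v (x + y)) (v (- y)) (v x) v-[x+y]-[-y]≤vx
    where
    v-[x+y]-[-y]≤vx : min∞ (v (x + y)) (v (- y)) ≤∞ v x
    v-[x+y]-[-y]≤vx = subst (min∞ (v (x + y)) (v (- y)) ≤∞_) (v-cong ([x+y]-y≈x x y)) (v-+ (x + y) (- y))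
  ...   | inj₁ v[x+y]≤vx = ≤∞-antisym v[x+y]≤vx (v-+-≥ (≤∞-refl (v x)) vx≤vy)
  ...   | inj₂ v[-y]≤vx  = ⊥-elim (vy≰vx (subst (_≤∞ v x) (v-‿ y) v[-y]≤vx))

module CriticalOrbit {c ℓ} (K : NumberField c ℓ) (a : NumberField.Carrier K) (P : FinitePlace K) where
  open NumberField K hiding (refl)
  open FinitePlace P
  open Valuation P
  open RingIdentities commRing

  f^ : ℕ → Carrier → Carrier
  f^ k = iter k (quad K a)

  ν : ℕ → ℤ∞
  ν k = v (f^ k 0#)

  ν-1 : ν 1 ≡ v a
  ν-1 = v-cong (trans (+-congʳ (zeroˡ 0#)) (+-identityˡ a))

  v-cseq : ∀ m → 1 ≤ m → v (cseq K a m) ≡ ν m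
  v-cseq (suc zero)    _ = ≡.trans (v-‿ a) (≡.sym ν-1)
  v-cseq (suc (suc j)) _ = refl

  v-f^-nonNeg : NonNeg (v a) → ∀ {x} → NonNeg (v x) → ∀ k → NonNeg (v (f^ k x))
  v-f^-nonNeg a≥0 x≥0 zero    = x≥0
  v-f^-nonNeg a≥0 x≥0 (suc k) =
    v-+-≥ (v-*-nonNeg (v-f^-nonNeg a≥0 x≥0 k) (v-f^-nonNeg a≥0 x≥0 k)) a≥0

  ν-nonNeg : NonNeg (v a) → ∀ k → NonNeg (ν k)
  ν-nonNeg a≥0 = v-f^-nonNeg a≥0 (subst NonNeg (≡.sym v-0) tt)

  ν-neg : ∀ {z} → v a ≡ fin z → z ℤ.< ℤ.0ℤ → ∀ k → ν (suc k) ≡ fin (ℤ.+ (2 ^ k) ℤ.* z)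
  ν-neg {z} va≡z z<0 zero = ≡.trans ν-1 (≡.trans va≡z (cong fin (≡.sym (ℤP.*-identityˡ z))))
  ν-neg {z} va≡z z<0 (suc k) = begin
    v (y * y + a)  ≡⟨ v-+-dominated (y * y) a (inj₂ va≰vy²) ⟩
    v (y * y)      ≡⟨ vy²≡t+t ⟩
    fin (t ℤ.+ t)  ≡⟨ cong fin (≡.sym (2^suc*z k z)) ⟩
    fin (ℤ.+ (2 ^ suc k) ℤ.* z) ∎
    where
    open ≡.≡-Reasoning
    y = f^ (suc k) 0#
    t = ℤ.+ (2 ^ k) ℤ.* z
    vy²≡t+t : v (y * y) ≡ fin (t ℤ.+ t)
    vy²≡t+t = ≡.trans (v-* y y) (cong (λ u → u +∞ u) (ν-neg va≡z z<0 k))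
    va≰vy² : ¬ (v a ≤∞ v (y * y))
    va≰vy² va≤vy² = ℤP.<-irrefl refl (ℤP.<-≤-trans
      (ℤP.<-≤-trans (neg⇒i+i<i (ℤP.≤-<-trans (2^k*z≤z z<0 k) z<0)) (2^k*z≤z z<0 k))
      (≡.subst₂ _≤∞_ va≡z vy²≡t+t va≤vy²))

  v-f^-sub-f^0 : NonNeg (v a) → ∀ {x} → NonNeg (v x) → ∀ k →
                 (v x +∞ v x) ≤∞ v (f^ (suc k) x - f^ (suc k) 0#)
  v-f^-sub-f^0 a≥0 {x} x≥0 zero = subst ((v x +∞ v x) ≤∞_) (≡.sym v[x²+a-0²-a]≡2vx) (≤∞-refl (v x +∞ v x))
    where
    v[x²+a-0²-a]≡2vx : v ((x * x + a) - (0# * 0# + a)) ≡ v x +∞ v x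
    v[x²+a-0²-a]≡2vx = ≡.trans (v-cong ([x²+a]-[y²+a]≈[x-y][x+y] a x 0#))
      (≡.trans (v-* (x - 0#) (x + 0#)) (≡.cong₂ _+∞_ (v-cong (x-0≈x x)) (v-cong (+-identityʳ x))))
  v-f^-sub-f^0 a≥0 {x} x≥0 (suc k) =
    subst ((v x +∞ v x) ≤∞_) (≡.sym (≡.trans (v-cong ([x²+a]-[y²+a]≈[x-y][x+y] a y z)) (v-* (y - z) (y + z))))
      (≤-+∞-nonNeg (v-f^-sub-f^0 a≥0 x≥0 k) (v-+-≥ (v-f^-nonNeg a≥0 x≥0 (suc k)) (ν-nonNeg a≥0 (suc k))))
    where
    y = f^ (suc k) x
    z = f^ (suc k) 0#

  ν-+-period : NonNeg (v a) → ∀ {n} → Pos (ν n) → ∀ k → 1 ≤ k → ν k ≤∞ ν n → ν (k ℕ.+ n) ≡ ν k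
  ν-+-period a≥0 {n} νn>0 (suc j) _ νk≤νn = begin
    v (f^ (suc j ℕ.+ n) 0#)   ≡⟨ cong v (iter-+ (suc j) n (quad K a) 0#) ⟩
    v (f^ (suc j) y)          ≡⟨ v-cong (x≈y+[x-y] (f^ (suc j) y) (f^ (suc j) 0#)) ⟩
    v (f^ (suc j) 0# + (f^ (suc j) y - f^ (suc j) 0#))
                              ≡⟨ v-+-dominated _ _ (Pos-double-≤⇒> νn>0 (v-f^-sub-f^0 a≥0 (ν-nonNeg a≥0 n) j) νk≤νn) ⟩
    ν (suc j)                 ∎
    where
    open ≡.≡-Reasoning
    y = f^ n 0#

  ν-pos⇒v-a-nonNeg : ∀ n → 1 ≤ n → Pos (ν n) → NonNeg (v a)
  ν-pos⇒v-a-nonNeg (suc k) _ νn>0 with nonNeg⊎neg (v a)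
  ... | inj₁ a≥0 = a≥0
  ... | inj₂ (z , va≡z , z<0) =
    ⊥-elim (ℤP.<-asym (ℤP.≤-<-trans (2^k*z≤z z<0 k) z<0) (subst Pos (ν-neg va≡z z<0 k) νn>0))

  cseq-neg : (n : ℕ) → 1 ≤ n →
        (Neg (v (cseq K a n)) ⇔ Neg (v (cseq K a 1)))
        × ((z : ℤ) → v (cseq K a 1) ≡ fin z → z ℤ.< ℤ.0ℤ →
             v (cseq K a n) ≡ fin (ℤ.+ (2 ^ (n ∸ 1)) ℤ.* z))
  cseq-neg n@(suc k) 1≤n = mk⇔ to-neg from-neg , valuation
    where
    v-c₁ : v (cseq K a 1) ≡ v a
    v-c₁ = v-‿ a
    valuation : (z : ℤ) → v (cseq K a 1) ≡ fin z → z ℤ.< ℤ.0ℤ →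
                v (cseq K a n) ≡ fin (ℤ.+ (2 ^ k) ℤ.* z)
    valuation z c₁≡z z<0 = ≡.trans (v-cseq n 1≤n) (ν-neg (≡.trans (≡.sym v-c₁) c₁≡z) z<0 k)
    to-neg : Neg (v (cseq K a n)) → Neg (v (cseq K a 1))
    to-neg cₙ<0 with nonNeg⊎neg (v a)
    ... | inj₁ a≥0 = ⊥-elim (Neg⇒¬NonNeg (subst Neg (v-cseq n 1≤n) cₙ<0) (ν-nonNeg a≥0 n))
    ... | inj₂ (z , va≡z , z<0) = subst Neg (≡.sym (≡.trans v-c₁ va≡z)) z<0
    from-neg : Neg (v (cseq K a 1)) → Neg (v (cseq K a n))
    from-neg c₁<0 with nonNeg⊎neg (v a)
    ... | inj₁ a≥0 = ⊥-elim (Neg⇒¬NonNeg (subst Neg v-c₁ c₁<0) a≥0)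
    ... | inj₂ (z , va≡z , z<0) = subst Neg (≡.sym (valuation z (≡.trans v-c₁ va≡z) z<0))
                                    (ℤP.≤-<-trans (2^k*z≤z z<0 k) z<0)

  module FirstPositive (n : ℕ) (1≤n : 1 ≤ n) (νn>0 : Pos (ν n))
                       (minimal : (i : ℕ) → 1 ≤ i → i < n → ¬ Pos (ν i)) where

    a≥0 : NonNeg (v a)
    a≥0 = ν-pos⇒v-a-nonNeg n 1≤n νn>0

    Periodic : ℕ → Set
    Periodic m = (n ∣ m → ν m ≡ ν n) × (¬ (n ∣ m) → ν m ≡ fin ℤ.0ℤ)

    Periodic⇒≤νn : ∀ {k} → Periodic k → ν k ≤∞ ν n
    Periodic⇒≤νn {k} (∣⇒≡ , ∤⇒≡0) with n ℕD.∣? k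
    ... | yes n∣k = subst (_≤∞ ν n) (≡.sym (∣⇒≡ n∣k)) (≤∞-refl (ν n))
    ... | no  n∤k = subst (_≤∞ ν n) (≡.sym (∤⇒≡0 n∤k)) (Pos⇒NonNeg νn>0)

    Periodic-+n : ∀ k → 1 ≤ k → Periodic k → Periodic (k ℕ.+ n)
    Periodic-+n k 1≤k per@(∣⇒≡ , ∤⇒≡0) = on-∣ , on-∤
      where
      ν[k+n]≡νk : ν (k ℕ.+ n) ≡ ν k
      ν[k+n]≡νk = ν-+-period a≥0 νn>0 k 1≤k (Periodic⇒≤νn per)
      on-∣ : n ∣ k ℕ.+ n → ν (k ℕ.+ n) ≡ ν n
      on-∣ n∣k+n = ≡.trans ν[k+n]≡νk (∣⇒≡ (ℕD.∣m+n∣m⇒∣n (subst (n ∣_) (ℕP.+-comm k n) n∣k+n) ℕD.∣-refl))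
      on-∤ : ¬ (n ∣ k ℕ.+ n) → ν (k ℕ.+ n) ≡ fin ℤ.0ℤ
      on-∤ n∤k+n = ≡.trans ν[k+n]≡νk (∤⇒≡0 (λ n∣k → n∤k+n (ℕD.∣m∣n⇒∣m+n n∣k ℕD.∣-refl)))

    periodic : ∀ m → 1 ≤ m → Periodic m
    periodic = <-rec (λ m → 1 ≤ m → Periodic m) step
      where
      step : ∀ m → (∀ {k} → k < m → 1 ≤ k → Periodic k) → 1 ≤ m → Periodic m
      step m@(suc _) rec 1≤m with ℕP.<-cmp m n
      ... | tri< m<n _ _ = (λ n∣m → ⊥-elim (ℕD.>⇒∤ m<n n∣m)) ,
                           (λ _ → ¬Pos⇒NonNeg⇒≡0 (minimal m 1≤m m<n) (ν-nonNeg a≥0 m))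
      ... | tri≈ _ refl _ = (λ _ → refl) , (λ n∤n → ⊥-elim (n∤n ℕD.∣-refl))
      ... | tri> _ _ n<m = subst Periodic (ℕP.m∸n+n≡m (ℕP.<⇒≤ n<m))
                             (Periodic-+n (m ∸ n) 1≤m-n (rec m-n<m 1≤m-n))
        where
        1≤m-n : 1 ≤ m ∸ n
        1≤m-n = ℕP.m<n⇒0<n∸m n<m
        m-n<m : m ∸ n < m
        m-n<m = ℕP.∸-monoʳ-< {m} {n} {0} 1≤n (ℕP.<⇒≤ n<m)

    cseq-periodic : (m : ℕ) → 1 ≤ m →
          (n ∣ m → v (cseq K a m) ≡ v (cseq K a n))
          × (¬ (n ∣ m) → v (cseq K a m) ≡ fin ℤ.0ℤ)
    cseq-periodic m 1≤m with periodic m 1≤m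
    ... | ∣⇒≡ , ∤⇒≡0 =
      (λ n∣m → ≡.trans (v-cseq m 1≤m) (≡.trans (∣⇒≡ n∣m) (≡.sym (v-cseq n 1≤n)))) ,
      (λ n∤m → ≡.trans (v-cseq m 1≤m) (∤⇒≡0 n∤m))

  cseq-first-positive : (n : ℕ) → 1 ≤ n → Pos (v (cseq K a n)) →
        ((i : ℕ) → 1 ≤ i → i < n → ¬ Pos (v (cseq K a i))) →
        (m : ℕ) → 1 ≤ m →
          (n ∣ m → v (cseq K a m) ≡ v (cseq K a n))
          × (¬ (n ∣ m) → v (cseq K a m) ≡ fin ℤ.0ℤ)
  cseq-first-positive n 1≤n cₙ>0 minimal =
    FirstPositive.cseq-periodic n 1≤n (subst Pos (v-cseq n 1≤n) cₙ>0)
      (λ i 1≤i i<n νi>0 → minimal i 1≤i i<n (subst Pos (≡.sym (v-cseq i 1≤i)) νi>0))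

lemma4p8 : ∀ {c ℓ} (K : NumberField c ℓ) (a : NumberField.Carrier K) (P : FinitePlace K) →
    ((n : ℕ) → 1 ≤ n →
        (Neg (FinitePlace.v P (cseq K a n)) ⇔ Neg (FinitePlace.v P (cseq K a 1)))
        × ((z : ℤ) → FinitePlace.v P (cseq K a 1) ≡ fin z → z ℤ.< ℤ.0ℤ →
             FinitePlace.v P (cseq K a n) ≡ fin (ℤ.+ (2 ^ (n ∸ 1)) ℤ.* z)))
    × ((n : ℕ) → 1 ≤ n → Pos (FinitePlace.v P (cseq K a n)) →
        ((i : ℕ) → 1 ≤ i → i < n → ¬ Pos (FinitePlace.v P (cseq K a i))) →
        (m : ℕ) → 1 ≤ m →
          (n ∣ m → FinitePlace.v P (cseq K a m) ≡ FinitePlace.v P (cseq K a n))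
          × (¬ (n ∣ m) → FinitePlace.v P (cseq K a m) ≡ fin ℤ.0ℤ))
lemma4p8 K a P = cseq-neg , cseq-first-positive
  where open CriticalOrbit K a P
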